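{- Let $G$ be a finite, simple, connected graph with at least one edge, on vertex set $\{1,\dots,N\}$, let $n=N-1$, and let $\nabla_G=\{\pm(\mathbf e_i-\mathbf e_j)\mid \{i,j\}\in\mathcal E(G)\}\subset\mathbb R^N$. Let $B$ be a maximal bipartite subgraph of $G$ with vertex bipartition $\mathcal V(B)=V_+\cup V_-$, let $T$ be a spanning tree of $B$, and let $\vec T$ be the canonical orientation of $T$, in which every edge is directed from its endpoint in $V_-$ to its endpoint in $V_+$. Fix an ordering $t_1,\dots,t_n$ of the directed edges of $\vec T$. For each edge $e\in\mathcal E(G)\setminus\mathcal E(T)$, let $\mathbf c_{\vec T}(e)\in\{ -1,0,1\}^n$ be the vector of the fundamental cycle of $e$ with respect to $T$, equipped with a chosen coherent orientation: its $k$-th entry is $+1$ if the oriented cycle traverses $t_k$ in the direction of $t_k$, $-1$ if it traverses $t_k$ in the opposite direction, and $0$ if $t_k$ is not on the cycle. Then there is a bijection between the set $\{F\mid F\text{ a facet of }\nabla_G,\ G_F=B\}$ and the set of vectors $\mathbf d\in\{\pm1\}^n$ (cut-set sign vectors of $T$ with respect to the cut $(V_+,V_-)$) satisfying $$\mathbf c_{\vec T}(e)^\top\mathbf d=\pm1\ \text{ for all } e\in\mathcal E(B)\setminus\mathcal E(T),\qquad \mathbf c_{\vec T}(e)^\top\mathbf d=0\ \text{ for all } e\in\mathcal E(G)\setminus\mathcal E(B).$$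
   Context: $\mathbf e_1,\dots,\mathbf e_N$ is the standard basis of $\mathbb R^N$. A subset $F\subseteq\nabla_G$ is a facet of $\nabla_G$ if $F=\nabla_G\cap P'$ for a facet $P'$ of the polytope $\operatorname{conv}(\nabla_G)$. $G_F$ is the undirected graph whose edges are the $\{i,j\}$ with $\mathbf e_i-\mathbf e_j\in F$ or $\mathbf e_j-\mathbf e_i\in F$ (vertices: their endpoints). A maximal bipartite subgraph of $G$ is a bipartite subgraph maximal under inclusion; it is spanning and connected, so $T$ is also a spanning tree of $G$. The fundamental cycle of $e\notin\mathcal E(T)$ is the unique cycle formed by $e$ and the path in $T$ joining its endpoints. A vector $\mathbf d\in\{\pm1\}^n$ is viewed as assigning to each edge $t_k$ of $T$ (all of which cross the cut $(V_+,V_-)$) a direction across the cut (same as or opposite to $t_k$); the sign ambiguity $\pm1$ reflects the arbitrary choice of orientation of each fundamental cycle. -}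

module Defs where

open import Data.Bool using (Bool; true; false; if_then_else_; _∨_)
open import Data.Nat using (ℕ; zero; suc; _≥_)
open import Data.Fin using (Fin) renaming (_≟_ to _≟ᶠ_)
open import Data.Product using (Σ; ∃; ∃-syntax; _×_; _,_; proj₁; proj₂)
open import Data.Product.Properties using (≡-dec)
open import Data.Sum using (_⊎_)
open import Data.List using (List; []; _∷_; length)
open import Data.List.Relation.Unary.Unique.Propositional using (Unique)
open import Data.Vec using (Vec; lookup; tabulate)
open import Data.Integer using (ℤ; +_; -[1+_]) renaming (_+_ to _+ℤ_; _*_ to _*ℤ_)
open import Data.Sign using (Sign)
open import Data.Rational using (ℚ) renaming (_-_ to _-ℚ_; _≤_ to _≤ℚ_)
open import Relation.Binary.PropositionalEquality using (_≡_; _≢_)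
open import Relation.Nullary using (¬_; does)

Rel : ℕ → Set
Rel N = Fin N → Fin N → Bool

record Graph (N : ℕ) : Set where
  field
    adj   : Rel N
    sym   : ∀ i j → adj i j ≡ true → adj j i ≡ true
    irrefl : ∀ i → adj i i ≡ false
open Graph public

HasEdge : ∀ {N} → Graph N → Set
HasEdge G = ∃[ i ] ∃[ j ] (adj G i j ≡ true)

data Walk {N : ℕ} (E : Rel N) : Fin N → Fin N → List (Fin N) → Set where
  here : ∀ {v} → Walk E v v (v ∷ [])
  step : ∀ {u w v p} → E u w ≡ true → Walk E w v p → Walk E u v (u ∷ p)

IsPath : ∀ {N} → Rel N → Fin N → Fin N → List (Fin N) → Set
IsPath E u v p = Walk E u v p × Unique p

Connected : ∀ {N} → Rel N → Set
Connected E = ∀ u v → ∃[ p ] Walk E u v p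

HasCycle : ∀ {N} → Rel N → Set
HasCycle E = ∃[ x₀ ] ∃[ xₖ ] ∃[ p ] (IsPath E x₀ xₖ p × length p ≥ 3 × E xₖ x₀ ≡ true)

Acyclic : ∀ {N} → Rel N → Set
Acyclic E = ¬ HasCycle E

SubgraphOf : ∀ {N} → Rel N → Rel N → Set
SubgraphOf E E' = (∀ i j → E i j ≡ true → E j i ≡ true)
                × (∀ i j → E i j ≡ true → E' i j ≡ true)

_⊆ᴱ_ : ∀ {N} → Rel N → Rel N → Set
E ⊆ᴱ E' = ∀ i j → E i j ≡ true → E' i j ≡ true

-- side i ≡ true means i ∈ V₊, side i ≡ false means i ∈ V₋
IsBipartition : ∀ {N} → Rel N → (Fin N → Bool) → Set
IsBipartition E side = ∀ i j → E i j ≡ true → side i ≢ side j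

Bipartite : ∀ {N} → Rel N → Set
Bipartite E = ∃[ side ] IsBipartition E side

MaximalBipartiteSubgraph : ∀ {N} → Graph N → Rel N → Set
MaximalBipartiteSubgraph G B =
  SubgraphOf B (adj G) × Bipartite B ×
  (∀ B' → SubgraphOf B' (adj G) → Bipartite B' → B ⊆ᴱ B' → B' ⊆ᴱ B)

SpanningTreeOf : ∀ {N} → Rel N → Rel N → Set
SpanningTreeOf B T = SubgraphOf T B × Connected T × Acyclic T

IsCanonicalOrdering : ∀ {N n} → Rel N → (Fin N → Bool) → (Fin n → Fin N × Fin N) → Set
IsCanonicalOrdering T side t =
  (∀ k → T (proj₁ (t k)) (proj₂ (t k)) ≡ true
         × side (proj₁ (t k)) ≡ false × side (proj₂ (t k)) ≡ true)
  × (∀ k l → t k ≡ t l → k ≡ l)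
  × (∀ i j → T i j ≡ true → ∃[ k ] (t k ≡ (i , j) ⊎ t k ≡ (j , i)))

consecutive : ∀ {A : Set} → List A → List (A × A)
consecutive []           = []
consecutive (x ∷ [])     = []
consecutive (x ∷ y ∷ xs) = (x , y) ∷ consecutive (y ∷ xs)

_≟ₚ_ : ∀ {N} (a b : Fin N × Fin N) → _
_≟ₚ_ = ≡-dec _≟ᶠ_ _≟ᶠ_

traverse : ∀ {N} → Fin N × Fin N → Fin N × Fin N → ℤ
traverse tk (x , y) =
  if does (tk ≟ₚ (x , y)) then + 1
  else if does (tk ≟ₚ (y , x)) then -[1+ 0 ] else + 0

sumℤ : List ℤ → ℤ
sumℤ []       = + 0
sumℤ (z ∷ zs) = z +ℤ sumℤ zs

-- For e = (u , v) ∉ T and p the T-path from v to u, the oriented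
-- fundamental cycle is u →(e) v →(p) u.  Since e ∉ T it contributes
-- nothing; the k-th entry is +1/−1/0 according to how p traverses tₖ.
cycleVec : ∀ {N n} → (Fin n → Fin N × Fin N) → List (Fin N) → Vec ℤ n
cycleVec t p = tabulate λ k → sumℤ (Data.List.map (traverse (t k)) (consecutive p))

dot : ∀ {n} → Vec ℤ n → Vec ℤ n → ℤ
dot {zero}  _ _ = + 0
dot {suc n} c d = lookup c Fin.zero *ℤ lookup d Fin.zero
                  +ℤ dot (tabulate λ k → lookup c (Fin.suc k)) (tabulate λ k → lookup d (Fin.suc k))

signℤ : Sign → ℤ
signℤ Sign.+ = + 1
signℤ Sign.- = -[1+ 0 ]

signVec : ∀ {n} → Vec Sign n → Vec ℤ n
signVec d = Data.Vec.map signℤ d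

ValidSignVector : ∀ {N n} → Graph N → Rel N → Rel N → (Fin n → Fin N × Fin N) → Vec Sign n → Set
ValidSignVector G B T t d =
  ∀ u v p → adj G u v ≡ true → T u v ≡ false → IsPath T v u p →
    (B u v ≡ true  → (dot (cycleVec t p) (signVec d) ≡ + 1
                      ⊎ dot (cycleVec t p) (signVec d) ≡ -[1+ 0 ]))
  × (B u v ≡ false → dot (cycleVec t p) (signVec d) ≡ + 0)

-- The symmetric edge polytope point set ∇_G ⊂ ℝᴺ: the pair (i , j) with
-- {i,j} ∈ E(G) stands for the point eᵢ − eⱼ.  A subset F ⊆ ∇_G is a
-- Boolean N×N matrix: F[i][j] = true iff eᵢ − eⱼ ∈ F.

PointSet : ℕ → Set
PointSet N = Vec (Vec Bool N) N

_∈F_ : ∀ {N} → Fin N × Fin N → PointSet N → Set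
(i , j) ∈F F = lookup (lookup F i) j ≡ true

InNabla : ∀ {N} → Graph N → Fin N → Fin N → Set
InNabla G i j = adj G i j ≡ true

-- F = ∇_G ∩ P' for a (nonempty) face P' of conv(∇_G): F is the set of
-- points of ∇_G maximising a linear functional h (h·(eᵢ−eⱼ) = hᵢ − hⱼ).
IsFace : ∀ {N} → Graph N → PointSet N → Set
IsFace {N} G F =
  Σ (Fin N → ℚ) λ h → Σ ℚ λ m →
    ((∀ i j → InNabla G i j → (h i -ℚ h j) ≤ℚ m)
    × (∀ i j → ((i , j) ∈F F → InNabla G i j × (h i -ℚ h j) ≡ m)
             × (InNabla G i j → (h i -ℚ h j) ≡ m → (i , j) ∈F F)))

IsProperFace : ∀ {N} → Graph N → PointSet N → Set
IsProperFace G F = IsFace G F × ∃[ i ] ∃[ j ] (InNabla G i j × ¬ ((i , j) ∈F F))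

_⊆F_ : ∀ {N} → PointSet N → PointSet N → Set
F ⊆F F' = ∀ i j → (i , j) ∈F F → (i , j) ∈F F'

IsFacet : ∀ {N} → Graph N → PointSet N → Set
IsFacet G F = IsProperFace G F × (∀ F' → IsProperFace G F' → F ⊆F F' → F' ⊆F F)

GraphOfFacetIs : ∀ {N} → PointSet N → Rel N → Set
GraphOfFacetIs F B = ∀ i j → (((i , j) ∈F F ⊎ (j , i) ∈F F) → B i j ≡ true)
                           × (B i j ≡ true → ((i , j) ∈F F ⊎ (j , i) ∈F F))

-- The sign vector d = (d₁,…,dₙ) is integrated along the spanning tree: there is an integer
-- potential φ with φ(tgt tₖ) − φ(src tₖ) = dₖ, and since the fundamental cycle of e = (u , v)
-- is e followed by the tree path from v back to u, c(e)ᵀd = φ(u) − φ(v).  The conditions on d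
-- therefore say that φ jumps by ±1 along the edges of B and by 0 along the other edges of G,
-- and then the eᵢ − eⱼ with φ(i) − φ(j) = 1 form a facet F with G_F = B.  Conversely, a facet F
-- with G_F = B contains each tree edge in exactly one direction, which defines d; its supporting
-- functional h, with value m > 0, satisfies h(tgt tₖ) − h(src tₖ) = m dₖ along the tree, so it
-- is m φ up to a constant and F is again the set where φ(i) − φ(j) = 1.  The two constructions
-- are therefore mutually inverse.

{-# OPTIONS --safe #-}
module Submission where

open import Defs hiding (sym)
import Data.Integer.Properties as ℤ
open import Algebra.Properties.Semiring.Sum ℤ.+-*-semiring
  using (sum; sum-syntax; sum-cong-≗; sum-replicate-zero; sum-remove; ∑-distrib-+)
open import Data.Bool using (Bool; true; false; if_then_else_)
import Data.Bool.Properties as Bool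
open import Data.Empty using (⊥; ⊥-elim)
open import Data.Fin using (Fin; zero; punchIn; _≟_)
open import Data.Fin.Properties using (punchInᵢ≢i)
open import Data.Integer as ℤ using (ℤ; +_; -[1+_]; _+_; _-_; _*_; -_; _≤_; +≤+)
open import Data.Integer.Tactic.RingSolver using (solve-∀)
open import Data.List using (List; []; _∷_; map; length)
open import Data.List.Membership.Propositional using (_∈_)
open import Data.List.Relation.Binary.Subset.Propositional using (_⊆_)
open import Data.List.Relation.Binary.Subset.Propositional.Properties using (⊆-refl; ⊆-trans; xs⊆x∷xs; ∷⁺ʳ)
open import Data.List.Relation.Unary.All using (All; []; _∷_)
open import Data.List.Relation.Unary.All.Properties using (anti-mono; ¬Any⇒All¬; All¬⇒¬Any)
open import Data.List.Relation.Unary.AllPairs using ([]; _∷_)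
open import Data.List.Relation.Unary.Any using (here; there)
open import Data.Nat as ℕ using (ℕ; suc; s≤s; z≤n)
open import Data.Product using (Σ; ∃-syntax; _×_; _,_; proj₁; proj₂; swap)
open import Data.Rational as ℚ using (ℚ; 0ℚ; 1ℚ; positive)
  renaming (_+_ to _+ℚ_; _-_ to _-ℚ_; _*_ to _*ℚ_; -_ to -ℚ_; _≤_ to _≤ℚ_; _<_ to _<ℚ_)
open import Data.Rational.Literals using (fromℤ)
import Data.Rational.Properties as ℚ
open import Data.Rational.Solver using (module +-*-Solver)
import Data.Rational.Unnormalised as ℚᵘ
import Data.Rational.Unnormalised.Properties as ℚᵘ
open import Data.Sign using (Sign)
open import Data.Sum using (_⊎_; inj₁; inj₂)
open import Data.Vec using (Vec; _∷_; lookup; tabulate)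
open import Data.Vec.Functional using (removeAt)
open import Data.Vec.Properties using (lookup∘tabulate; tabulate∘lookup; tabulate-cong; lookup-map)
open import Function using (_∘_; _⇔_; mk⇔; Equivalence)
import Function.Properties.Equivalence as ⇔
open import Relation.Binary.PropositionalEquality
open import Relation.Nullary using (¬_; Dec; yes; no; contradiction)
open import Relation.Nullary.Decidable using (does; dec-true; dec-false; _×-dec_)

open +-*-Solver using (solve; _:=_; _:+_; _:-_; :-_; _:*_)

≢±1⇒≡0 : ∀ x → x ≤ + 1 → - x ≤ + 1 → x ≢ + 1 → - x ≢ + 1 → x ≡ + 0
≢±1⇒≡0 (+ 0)           _              _              _   _    = refl
≢±1⇒≡0 (+ 1)           _              _              x≢1 _    = ⊥-elim (x≢1 refl)
≢±1⇒≡0 (+ suc (suc _)) (+≤+ (s≤s ())) _              _   _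
≢±1⇒≡0 -[1+ 0 ]        _              _              _   -x≢1 = ⊥-elim (-x≢1 refl)
≢±1⇒≡0 -[1+ suc _ ]    _              (+≤+ (s≤s ())) _   _

minus-swap : ∀ i j → j - i ≡ - (i - j)
minus-swap = solve-∀

fromℤ-injective : ∀ {a b} → fromℤ a ≡ fromℤ b → a ≡ b
fromℤ-injective = cong ℚ.numerator

fromℤ-mono-≤ : ∀ {a b} → a ≤ b → fromℤ a ≤ℚ fromℤ b
fromℤ-mono-≤ {a} {b} a≤b = ℚ.*≤* (subst₂ _≤_ (sym (ℤ.*-identityʳ a)) (sym (ℤ.*-identityʳ b)) a≤b)

fromℤ-cancel-≤ : ∀ {a b} → fromℤ a ≤ℚ fromℤ b → a ≤ b
fromℤ-cancel-≤ {a} {b} (ℚ.*≤* le) = subst₂ _≤_ (ℤ.*-identityʳ a) (ℤ.*-identityʳ b) le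

fromℤ-homo-+ : ∀ a b → fromℤ (a + b) ≡ fromℤ a +ℚ fromℤ b
fromℤ-homo-+ a b = ℚ.toℚᵘ-injective
  (ℚᵘ.≃-trans (ℚᵘ.*≡* (identity a b)) (ℚᵘ.≃-sym (ℚ.toℚᵘ-homo-+ (fromℤ a) (fromℤ b))))
  where
  identity : ∀ a b → (a + b) * + 1 ≡ (a * + 1 + b * + 1) * + 1
  identity = solve-∀

fromℤ-homo-neg : ∀ a → fromℤ (- a) ≡ -ℚ fromℤ a
fromℤ-homo-neg (+ 0)       = refl
fromℤ-homo-neg (+ suc _) = refl
fromℤ-homo-neg -[1+ _ ]    = refl

fromℤ-homo-- : ∀ a b → fromℤ (a - b) ≡ fromℤ a -ℚ fromℤ b
fromℤ-homo-- a b = trans (fromℤ-homo-+ a (- b)) (cong (fromℤ a +ℚ_) (fromℤ-homo-neg b))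

*-cancelˡ-≡-pos : ∀ m {p q} → 0ℚ <ℚ m → m *ℚ p ≡ m *ℚ q → p ≡ q
*-cancelˡ-≡-pos m 0<m eq = ℚ.≤-antisym
  (ℚ.*-cancelˡ-≤-pos m {{positive 0<m}} (ℚ.≤-reflexive eq))
  (ℚ.*-cancelˡ-≤-pos m {{positive 0<m}} (ℚ.≤-reflexive (sym eq)))

minusℚ-swap : ∀ p q → q -ℚ p ≡ -ℚ (p -ℚ q)
minusℚ-swap = solve 2 (λ p q → q :- p := :- (p :- q)) refl

minusℚ-telescope : ∀ p q r → (p -ℚ q) +ℚ (q -ℚ r) ≡ p -ℚ r
minusℚ-telescope = solve 3 (λ p q r → (p :- q) :+ (q :- r) := p :- r) refl

*-distribˡ-minusℚ : ∀ m p q → m *ℚ (p -ℚ q) ≡ m *ℚ p -ℚ m *ℚ q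
*-distribˡ-minusℚ = solve 3 (λ m p q → m :* (p :- q) := m :* p :- m :* q) refl

sum-single : ∀ {n} (f : Fin n → ℤ) k → (∀ l → l ≢ k → f l ≡ + 0) → sum f ≡ f k
sum-single {suc n} f k others = begin
  sum f                     ≡⟨ sum-remove {i = k} f ⟩
  f k + sum (removeAt f k)  ≡⟨ cong (λ s → f k + s) rest≡0 ⟩
  f k + + 0                 ≡⟨ ℤ.+-identityʳ (f k) ⟩
  f k                       ∎
  where
  open ≡-Reasoning
  rest≡0 : sum (removeAt f k) ≡ + 0
  rest≡0 = trans (sum-cong-≗ (λ l → others (punchIn k l) (punchInᵢ≢i k l))) (sum-replicate-zero n)

dot-as-sum : ∀ {n} (c v : Vec ℤ n) → dot c v ≡ ∑[ k < n ] (lookup c k * lookup v k)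
dot-as-sum {ℕ.zero}  c v = refl
dot-as-sum {suc n} (x ∷ c) (y ∷ v) =
  cong (λ s → x * y + s) (trans (cong₂ dot (tabulate∘lookup c) (tabulate∘lookup v)) (dot-as-sum c v))

∑-sumℤ-comm : ∀ {A : Set} {n} (f : Fin n → A → ℤ) (c : Fin n → ℤ) (L : List A) →
  ∑[ k < n ] (sumℤ (map (f k) L) * c k) ≡ sumℤ (map (λ e → ∑[ k < n ] (f k e * c k)) L)
∑-sumℤ-comm {n = n} f c []      = trans (sum-cong-≗ (λ k → ℤ.*-zeroˡ (c k))) (sum-replicate-zero n)
∑-sumℤ-comm {n = n} f c (e ∷ L) = begin
  ∑[ k < n ] ((f k e + sumℤ (map (f k) L)) * c k)
    ≡⟨ sum-cong-≗ (λ k → ℤ.*-distribʳ-+ (c k) (f k e) _) ⟩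
  ∑[ k < n ] (f k e * c k + sumℤ (map (f k) L) * c k)
    ≡⟨ ∑-distrib-+ (λ k → f k e * c k) _ ⟩
  ∑[ k < n ] (f k e * c k) + ∑[ k < n ] (sumℤ (map (f k) L) * c k)
    ≡⟨ cong (λ s → sum (λ k → f k e * c k) + s) (∑-sumℤ-comm f c L) ⟩
  ∑[ k < n ] (f k e * c k) + sumℤ (map (λ e → ∑[ k < n ] (f k e * c k)) L) ∎
  where open ≡-Reasoning

module _ {N : ℕ} where

  traverse-along : ∀ (e : Fin N × Fin N) → traverse e e ≡ + 1
  traverse-along e =
    cong (λ b → if b then + 1 else (if does (e ≟ₚ swap e) then -[1+ 0 ] else + 0)) (dec-true (e ≟ₚ e) refl)

  traverse-against : ∀ {x y : Fin N} → x ≢ y → traverse (y , x) (x , y) ≡ -[1+ 0 ]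
  traverse-against {x} {y} x≢y = cong₂ (λ b b′ → if b then + 1 else (if b′ then -[1+ 0 ] else + 0))
    (dec-false ((y , x) ≟ₚ (x , y)) (λ eq → x≢y (cong proj₂ eq)))
    (dec-true ((y , x) ≟ₚ (y , x)) refl)

  traverse-elsewhere : ∀ {e e′ : Fin N × Fin N} → e ≢ e′ → e ≢ swap e′ → traverse e e′ ≡ + 0
  traverse-elsewhere {e} {e′} e≢e′ e≢e′ᵀ =
    cong₂ (λ b b′ → if b then + 1 else (if b′ then -[1+ 0 ] else + 0))
          (dec-false (e ≟ₚ e′) e≢e′) (dec-false (e ≟ₚ swap e′) e≢e′ᵀ)

module _ {N n : ℕ} (t : Fin n → Fin N × Fin N) where

  edgeWeight : Vec ℤ n → Fin N × Fin N → ℤ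
  edgeWeight v e = ∑[ k < n ] (traverse (t k) e * lookup v k)

  dot-cycleVec : ∀ v p → dot (cycleVec t p) v ≡ sumℤ (map (edgeWeight v) (consecutive p))
  dot-cycleVec v p = begin
    dot (cycleVec t p) v
      ≡⟨ dot-as-sum (cycleVec t p) v ⟩
    ∑[ k < n ] (lookup (cycleVec t p) k * lookup v k)
      ≡⟨ sum-cong-≗ (λ k → cong (_* lookup v k) (lookup∘tabulate _ k)) ⟩
    ∑[ k < n ] (sumℤ (map (traverse (t k)) (consecutive p)) * lookup v k)
      ≡⟨ ∑-sumℤ-comm (λ k → traverse (t k)) (lookup v) (consecutive p) ⟩
    sumℤ (map (edgeWeight v) (consecutive p)) ∎
    where open ≡-Reasoning

-- Paths in acyclic graphs and potentials

module Paths {N : ℕ} (E : Rel N) where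

  open import Data.List.Membership.DecPropositional (_≟_ {N}) using (_∈?_)

  walk-start : ∀ {u v x p} → Walk E u v (x ∷ p) → u ≡ x
  walk-start here       = refl
  walk-start (step _ _) = refl

  walk-start-∈ : ∀ {u v p} → Walk E u v p → u ∈ p
  walk-start-∈ here       = here refl
  walk-start-∈ (step _ _) = here refl

  walk-end-∈ : ∀ {u v p} → Walk E u v p → v ∈ p
  walk-end-∈ here        = here refl
  walk-end-∈ (step _ wk) = there (walk-end-∈ wk)

  walk-length≥2 : ∀ {u v p} → Walk E u v p → u ≢ v → 2 ℕ.≤ length p
  walk-length≥2 here                u≢v = ⊥-elim (u≢v refl)
  walk-length≥2 (step _ here)       _   = s≤s (s≤s z≤n)
  walk-length≥2 (step _ (step _ _)) _   = s≤s (s≤s z≤n)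

  consecutive-step : ∀ {u w v p} → Walk E w v p → consecutive (u ∷ p) ≡ (u , w) ∷ consecutive p
  consecutive-step here       = refl
  consecutive-step (step _ _) = refl

  path-prefix : ∀ {u v y p} → IsPath E u v p → y ∈ p → ∃[ q ] (IsPath E u y q × q ⊆ p)
  path-prefix (here , _)     (here refl) = _ , (here , [] ∷ []) , ⊆-refl
  path-prefix (step _ _ , _) (here refl) = _ , (here , [] ∷ []) , ∷⁺ʳ _ (λ ())
  path-prefix (here , _)     (there ())
  path-prefix (step e wk , (fresh ∷ unique)) (there y∈) with path-prefix (wk , unique) y∈
  ... | q , (wq , uq) , q⊆ = _ ∷ q , (step e wq , anti-mono q⊆ fresh ∷ uq) , ∷⁺ʳ _ q⊆

  path-suffix : ∀ {u v y p} → IsPath E u v p → y ∈ p → ∃[ q ] (IsPath E y v q × q ⊆ p)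
  path-suffix (wk , unique) (here refl) with walk-start wk
  ... | refl = _ , (wk , unique) , ⊆-refl
  path-suffix (here , _) (there ())
  path-suffix (step _ wk , (_ ∷ unique)) (there y∈) with path-suffix (wk , unique) y∈
  ... | q , πq , q⊆ = q , πq , ⊆-trans q⊆ (xs⊆x∷xs _ _)

  walk⇒path : ∀ {u v p} → Walk E u v p → ∃[ q ] IsPath E u v q
  walk⇒path here = _ , here , [] ∷ []
  walk⇒path {u} (step e wk) with walk⇒path wk
  ... | q , (wq , uq) with u ∈? q
  ...   | yes u∈q = let (q′ , πq′ , _) = path-suffix (wq , uq) u∈q in q′ , πq′
  ...   | no  u∉q = u ∷ q , step e wq , ¬Any⇒All¬ q u∉q ∷ uq

  telescope : ∀ (w : Fin N × Fin N → ℤ) (φ : Fin N → ℤ) →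
              (∀ x y → E x y ≡ true → w (x , y) ≡ φ y - φ x) → ∀ {u v p} → Walk E u v p → sumℤ (map w (consecutive p)) ≡ φ v - φ u
  telescope w φ edge {v = v} here = sym (ℤ.+-inverseʳ (φ v))
  telescope w φ edge {u} {v} (step {w = x} {p = p} e wk) = begin
    sumℤ (map w (consecutive (u ∷ p)))     ≡⟨ cong (sumℤ ∘ map w) (consecutive-step wk) ⟩
    w (u , x) + sumℤ (map w (consecutive p)) ≡⟨ cong₂ _+_ (edge u x e) (telescope w φ edge wk) ⟩
    (φ x - φ u) + (φ v - φ x)               ≡⟨ ℤ.+-comm (φ x - φ u) _ ⟩
    (φ v - φ x) + (φ x - φ u)               ≡⟨ ℤ.+-minus-telescope (φ v) (φ x) (φ u) ⟩
    φ v - φ u                               ∎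
    where open ≡-Reasoning

  differences-agree : Connected E → (f g : Fin N → ℚ) →
    (∀ x y → E x y ≡ true → f y -ℚ f x ≡ g y -ℚ g x) → ∀ u v → f v -ℚ f u ≡ g v -ℚ g u
  differences-agree connected f g edge u v = along (proj₂ (connected u v))
    where
    along : ∀ {u v p} → Walk E u v p → f v -ℚ f u ≡ g v -ℚ g u
    along {u} here = trans (ℚ.+-inverseʳ (f u)) (sym (ℚ.+-inverseʳ (g u)))
    along {u} {v} (step {w = x} e wk) = begin
      f v -ℚ f u                    ≡⟨ minusℚ-telescope (f v) (f x) (f u) ⟨
      (f v -ℚ f x) +ℚ (f x -ℚ f u)  ≡⟨ cong₂ _+ℚ_ (along wk) (edge u x e) ⟩
      (g v -ℚ g x) +ℚ (g x -ℚ g u)  ≡⟨ minusℚ-telescope (g v) (g x) (g u) ⟩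
      g v -ℚ g u                    ∎
      where open ≡-Reasoning

module Forest {N : ℕ} (E : Rel N) (E-sym : ∀ x y → E x y ≡ true → E y x ≡ true) (acyclic : Acyclic E) where

  open Paths E
  open import Data.List.Membership.DecPropositional (_≟_ {N}) using (_∈?_)

  no-detour : ∀ {u x y z p} → E u x ≡ true → E y u ≡ true → IsPath E x z p → All (u ≢_) p →
              y ∈ p → x ≢ y → ⊥
  no-detour {u} {x} {y} eux eyu πp u∉p y∈p x≢y with path-prefix πp y∈p
  ... | q , (wq , uq) , q⊆p =
    acyclic (u , y , u ∷ q , (step eux wq , anti-mono q⊆p u∉p ∷ uq) , s≤s (walk-length≥2 wq x≢y) , eyu)

  path-unique : ∀ {u v p q} → IsPath E u v p → IsPath E u v q → p ≡ q
  path-unique (here , _) (here , _) = refl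
  path-unique (here , _) (step _ wq , (u∉q ∷ _)) = ⊥-elim (All¬⇒¬Any u∉q (walk-end-∈ wq))
  path-unique (step _ wp , (u∉p ∷ _)) (here , _) = ⊥-elim (All¬⇒¬Any u∉p (walk-end-∈ wp))
  path-unique {u} {v} (step {w = x} {p = p} ex wp , (u∉p ∷ up)) (step {w = y} ey wq , (u∉q ∷ uq))
    with x ≟ y
  ... | yes refl = cong (u ∷_) (path-unique (wp , up) (wq , uq))
  ... | no x≢y with y ∈? p
  ...   | yes y∈p = ⊥-elim (no-detour ex (E-sym u y ey) (wp , up) u∉p y∈p x≢y)
  ...   | no  y∉p = ⊥-elim (All¬⇒¬Any u∉q (subst (u ∈_) (path-unique detour (wq , uq)) u∈detour))
    where
    u∈detour : u ∈ y ∷ u ∷ p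
    u∈detour = there (here refl)

    detour : IsPath E y v (y ∷ u ∷ p)
    detour = step (E-sym u y ey) (step ex wp) ,
             ((λ y≡u → All¬⇒¬Any u∉q (subst (_∈ _) y≡u (walk-start-∈ wq))) ∷ ¬Any⇒All¬ p y∉p)
             ∷ u∉p ∷ up

  module _ (edge-irrefl : ∀ x y → E x y ≡ true → x ≢ y) (w : Fin N × Fin N → ℤ)
           (w-antisym : ∀ x y → E x y ≡ true → w (y , x) ≡ - w (x , y)) where

    weightOf : List (Fin N) → ℤ
    weightOf p = sumℤ (map w (consecutive p))

    weightOf-adjacent : ∀ {a b r p q} → E a b ≡ true → IsPath E a r p → IsPath E b r q →
                        weightOf p ≡ w (a , b) + weightOf q
    -- If a lies on the path from b, acyclicity forces it to be the vertex right after b.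
    weightOf-adjacent {a} {b} {r} {p} {q} eab πa πb with a ∈? q
    ... | no a∉q = trans (cong weightOf (path-unique πa (step eab (proj₁ πb) , ¬Any⇒All¬ q a∉q ∷ proj₂ πb)))
                         (cong (sumℤ ∘ map w) (consecutive-step (proj₁ πb)))
    ... | yes a∈q = through-a πb a∈q
      where
      through-a : ∀ {q} → IsPath E b r q → a ∈ q → weightOf p ≡ w (a , b) + weightOf q
      through-a (here , _) (here a≡b) = ⊥-elim (edge-irrefl a b eab a≡b)
      through-a (step _ _ , _) (here a≡b) = ⊥-elim (edge-irrefl a b eab a≡b)
      through-a (step {w = c} {p = q′} ebc wc , (b∉q′ ∷ uc)) (there a∈q′) with c ≟ a
      ... | no c≢a = ⊥-elim (no-detour ebc eab (wc , uc) b∉q′ a∈q′ c≢a)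
      ... | yes refl = begin
        weightOf p                              ≡⟨ cong weightOf (path-unique πa (wc , uc)) ⟩
        weightOf q′                             ≡⟨ cancel (w (a , b)) (weightOf q′) ⟩
        w (a , b) + (- w (a , b) + weightOf q′) ≡⟨ cong (λ z → w (a , b) + (z + weightOf q′)) (w-antisym a b eab) ⟨
        w (a , b) + (w (b , a) + weightOf q′)   ≡⟨ cong (λ z → w (a , b) + sumℤ (map w z)) (consecutive-step wc) ⟨
        w (a , b) + weightOf (b ∷ q′)           ∎
        where
        open ≡-Reasoning
        cancel : ∀ x y → y ≡ x + (- x + y)
        cancel = solve-∀

    potential : Connected E → Fin N → Σ (Fin N → ℤ) λ φ → ∀ x y → E x y ≡ true → w (x , y) ≡ φ y - φ x
    potential connected root = φ , φ-edge
      where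
      pathToRoot : ∀ v → ∃[ p ] IsPath E v root p
      pathToRoot v = walk⇒path (proj₂ (connected v root))

      φ : Fin N → ℤ
      φ v = - weightOf (proj₁ (pathToRoot v))

      φ-edge : ∀ x y → E x y ≡ true → w (x , y) ≡ φ y - φ x
      φ-edge x y exy = trans (negate-difference (w (x , y)) (weightOf (proj₁ (pathToRoot y))))
        (cong (λ z → φ y - - z) (sym (weightOf-adjacent exy (proj₂ (pathToRoot x)) (proj₂ (pathToRoot y)))))
        where
        negate-difference : ∀ a b → a ≡ - b - - (a + b)
        negate-difference = solve-∀

Jump : Bool → ℤ → Set
Jump true  δ = δ ≡ + 1 ⊎ δ ≡ -[1+ 0 ]
Jump false δ = δ ≡ + 0

Jump-≤1 : ∀ b δ → Jump b δ → δ ≤ + 1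
Jump-≤1 true  _ (inj₁ refl) = ℤ.≤-refl
Jump-≤1 true  _ (inj₂ refl) = ℤ.-≤+
Jump-≤1 false _ refl        = ℤ.+≤+ z≤n

Jump-1⇒true : ∀ b δ → Jump b δ → δ ≡ + 1 → b ≡ true
Jump-1⇒true true  _ _ _ = refl
Jump-1⇒true false _ refl ()

signℤ-jump : ∀ σ → Jump true (signℤ σ)
signℤ-jump Sign.+ = inj₁ refl
signℤ-jump Sign.- = inj₂ refl

Jump-neg : ∀ {δ} → Jump true δ → Jump true (- δ)
Jump-neg (inj₁ refl) = inj₂ refl
Jump-neg (inj₂ refl) = inj₁ refl

Jump-by-cases : ∀ b δ → (b ≡ true → Jump true δ) → (b ≡ false → Jump false δ) → Jump b δ
Jump-by-cases true  _ jump _    = jump refl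
Jump-by-cases false _ _    jump = jump refl

Jump-split : ∀ b δ → Jump b δ → (b ≡ true → Jump true δ) × (b ≡ false → Jump false δ)
Jump-split b δ jump = (λ { refl → jump }) , (λ { refl → jump })

-- Faces of the symmetric edge polytope

does≡true⇔ : ∀ {A : Set} (a? : Dec A) → does a? ≡ true ⇔ A
does≡true⇔ (yes a) = mk⇔ (λ _ → a) (λ _ → refl)
does≡true⇔ (no ¬a) = mk⇔ (λ ()) (λ a → ⊥-elim (¬a a))

module Faces {N : ℕ} (G : Graph N) where

  Supports : PointSet N → (Fin N → ℚ) → ℚ → Set
  Supports F h m = (∀ i j → InNabla G i j → (h i -ℚ h j) ≤ℚ m)
                 × (∀ i j → ((i , j) ∈F F → InNabla G i j × (h i -ℚ h j) ≡ m)
                          × (InNabla G i j → (h i -ℚ h j) ≡ m → (i , j) ∈F F))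

  supports-value-pos : ∀ {F h m i j} → Supports F h m → InNabla G i j → ¬ (i , j) ∈F F → 0ℚ <ℚ m
  supports-value-pos {F} {h} {m} {i} {j} (bound , mem) gij ij∉F with m ℚ.≤? 0ℚ
  ... | no  m≰0 = ℚ.≰⇒> m≰0
  ... | yes m≤0 = ⊥-elim (ij∉F (proj₂ (mem i j) gij (ℚ.≤-antisym (bound i j gij) m≤hij)))
    where
    0≤hij : 0ℚ ≤ℚ h i -ℚ h j
    0≤hij = subst (0ℚ ≤ℚ_) (sym (minusℚ-swap (h j) (h i)))
                  (ℚ.neg-antimono-≤ (ℚ.≤-trans (bound j i (Graph.sym G i j gij)) m≤0))
    m≤hij : m ≤ℚ h i -ℚ h j
    m≤hij = ℚ.≤-trans m≤0 0≤hij

  supports-rescale : ∀ {F h m} (g : Fin N → ℚ) → Supports F h m → 0ℚ <ℚ m →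
                     (∀ i j → h i -ℚ h j ≡ m *ℚ (g i -ℚ g j)) → Supports F g 1ℚ
  supports-rescale {F} {h} {m} g (bound , mem) 0<m scaled = bound′ , mem′
    where
    m* : ∀ {i j} → (h i -ℚ h j) ≡ m → m *ℚ (g i -ℚ g j) ≡ m *ℚ 1ℚ
    m* {i} {j} eq = trans (sym (scaled i j)) (trans eq (sym (ℚ.*-identityʳ m)))

    bound′ : ∀ i j → InNabla G i j → (g i -ℚ g j) ≤ℚ 1ℚ
    bound′ i j gij = ℚ.*-cancelˡ-≤-pos m {{positive 0<m}}
      (subst₂ _≤ℚ_ (scaled i j) (sym (ℚ.*-identityʳ m)) (bound i j gij))

    mem′ : ∀ i j → ((i , j) ∈F F → InNabla G i j × (g i -ℚ g j) ≡ 1ℚ)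
                 × (InNabla G i j → (g i -ℚ g j) ≡ 1ℚ → (i , j) ∈F F)
    mem′ i j = (λ ij∈F → let (gij , hij≡m) = proj₁ (mem i j) ij∈F in gij , *-cancelˡ-≡-pos m 0<m (m* hij≡m))
             , (λ gij gij≡1 → proj₂ (mem i j) gij
                 (trans (scaled i j) (trans (cong (m *ℚ_) gij≡1) (ℚ.*-identityʳ m))))

  unitStep? : ∀ (φ : Fin N → ℤ) i j → Dec (adj G i j ≡ true × φ i - φ j ≡ + 1)
  unitStep? φ i j = (adj G i j Bool.≟ true) ×-dec (φ i - φ j ℤ.≟ + 1)

  faceOf : (Fin N → ℤ) → PointSet N
  faceOf φ = tabulate λ i → tabulate λ j → does (unitStep? φ i j)

  ∈faceOf⇔ : ∀ φ i j → (i , j) ∈F faceOf φ ⇔ (adj G i j ≡ true × φ i - φ j ≡ + 1)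
  ∈faceOf⇔ φ i j = subst (λ b → b ≡ true ⇔ (adj G i j ≡ true × φ i - φ j ≡ + 1)) (sym entry)
                         (does≡true⇔ (unitStep? φ i j))
    where
    entry : lookup (lookup (faceOf φ) i) j ≡ does (unitStep? φ i j)
    entry = trans (cong (λ row → lookup row j) (lookup∘tabulate _ i)) (lookup∘tabulate _ j)

  ∈F-ext : ∀ {F F′ : PointSet N} → (∀ i j → (i , j) ∈F F ⇔ (i , j) ∈F F′) → F ≡ F′
  ∈F-ext {F} {F′} same = trans (sym (tabulate∘lookup F)) (trans (tabulate-cong row≡) (tabulate∘lookup F′))
    where
    row≡ : ∀ i → lookup F i ≡ lookup F′ i
    row≡ i = trans (sym (tabulate∘lookup (lookup F i)))
                   (trans (tabulate-cong (λ j → Bool.⇔→≡ (same i j))) (tabulate∘lookup (lookup F′ i)))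

  record IsTopFaceOf (F : PointSet N) (φ : Fin N → ℤ) : Set where
    constructor topFace
    field
      bounded : ∀ i j → adj G i j ≡ true → φ i - φ j ≤ + 1
      members : ∀ i j → (i , j) ∈F F ⇔ (adj G i j ≡ true × φ i - φ j ≡ + 1)

  supports⇒topFace : ∀ {F φ} → Supports F (fromℤ ∘ φ) 1ℚ → IsTopFaceOf F φ
  supports⇒topFace {F} {φ} (bound , mem) = topFace
      (λ i j gij → fromℤ-cancel-≤ (subst (_≤ℚ 1ℚ) (sym (fromℤ-homo-- (φ i) (φ j))) (bound i j gij)))
      (λ i j → mk⇔ (λ ij∈F → let (gij , eq) = proj₁ (mem i j) ij∈F
                              in gij , fromℤ-injective (trans (fromℤ-homo-- (φ i) (φ j)) eq))
                   (λ (gij , eq) → proj₂ (mem i j) gij (trans (sym (fromℤ-homo-- (φ i) (φ j))) (cong fromℤ eq))))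

  topFace⇒supports : ∀ {F φ} → IsTopFaceOf F φ → Supports F (fromℤ ∘ φ) 1ℚ
  topFace⇒supports {F} {φ} (topFace bounded mem) =
      (λ i j gij → subst (_≤ℚ 1ℚ) (fromℤ-homo-- (φ i) (φ j)) (fromℤ-mono-≤ (bounded i j gij)))
    , (λ i j → (λ ij∈F → let (gij , eq) = Equivalence.to (mem i j) ij∈F
                         in gij , trans (sym (fromℤ-homo-- (φ i) (φ j))) (cong fromℤ eq))
             , (λ gij eq → Equivalence.from (mem i j) (gij , fromℤ-injective (trans (fromℤ-homo-- (φ i) (φ j)) eq))))

  topFace⇒≡faceOf : ∀ {F φ} → IsTopFaceOf F φ → F ≡ faceOf φ
  topFace⇒≡faceOf {F} {φ} (topFace _ mem) = ∈F-ext (λ i j → ⇔.trans (mem i j) (⇔.sym (∈faceOf⇔ φ i j)))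

  faceOf-proper : ∀ φ → HasEdge G → ∃[ i ] ∃[ j ] (InNabla G i j × ¬ (i , j) ∈F faceOf φ)
  faceOf-proper φ (i , j , gij) with φ i - φ j ℤ.≟ + 1
  ... | no  ≢1 = i , j , gij , λ ij∈ → ≢1 (proj₂ (Equivalence.to (∈faceOf⇔ φ i j) ij∈))
  ... | yes ≡1 = j , i , Graph.sym G i j gij , λ ji∈ → -1≢1 (trans (cong -_ (sym ≡1))
                   (trans (sym (minus-swap (φ i) (φ j))) (proj₂ (Equivalence.to (∈faceOf⇔ φ j i) ji∈))))
    where
    -1≢1 : -[1+ 0 ] ≢ + 1
    -1≢1 ()

  topFace-unit : ∀ {F φ} → IsTopFaceOf F φ → ∀ {i j} → (i , j) ∈F F → φ i - φ j ≡ + 1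
  topFace-unit (topFace _ mem) {i} {j} ij∈F = proj₂ (Equivalence.to (mem i j) ij∈F)

  IsLayering : Rel N → (Fin N → ℤ) → Set
  IsLayering B φ = ∀ i j → adj G i j ≡ true → Jump (B i j) (φ i - φ j)

  topFace⇒layering : ∀ {F φ B} → IsTopFaceOf F φ → GraphOfFacetIs F B → IsLayering B φ
  topFace⇒layering {F} {φ} {B} top graph i j gij with B i j in Bij
  ... | true with proj₂ (graph i j) Bij
  ...   | inj₁ ij∈F = inj₁ (topFace-unit top {i} {j} ij∈F)
  ...   | inj₂ ji∈F = inj₂ (trans (minus-swap (φ j) (φ i)) (cong -_ (topFace-unit top {j} {i} ji∈F)))
  topFace⇒layering {F} {φ} {B} (topFace bounded mem) graph i j gij | false =
    ≢±1⇒≡0 (φ i - φ j) (bounded i j gij)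
      (subst (_≤ + 1) (minus-swap (φ i) (φ j)) (bounded j i gji))
      (λ ≡1 → not-in-B (inj₁ (Equivalence.from (mem i j) (gij , ≡1))))
      (λ ≡1 → not-in-B (inj₂ (Equivalence.from (mem j i) (gji , trans (minus-swap (φ i) (φ j)) ≡1))))
    where
    gji : adj G j i ≡ true
    gji = Graph.sym G i j gij
    not-in-B : ¬ ((i , j) ∈F F ⊎ (j , i) ∈F F)
    not-in-B x with trans (sym Bij) (proj₁ (graph i j) x)
    ... | ()

  layering⇒bounded : ∀ {B φ} → IsLayering B φ → ∀ i j → adj G i j ≡ true → φ i - φ j ≤ + 1
  layering⇒bounded {B} {φ} layers i j gij = Jump-≤1 (B i j) (φ i - φ j) (layers i j gij)

  layering⇒graphOfFacet : ∀ {B φ} → (∀ i j → B i j ≡ true → B j i ≡ true) → B ⊆ᴱ adj G →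
                          IsLayering B φ → GraphOfFacetIs (faceOf φ) B
  layering⇒graphOfFacet {B} {φ} B-sym B⊆G layers i j = into-B , out-of-B
    where
    unit⇒B : ∀ i j → (i , j) ∈F faceOf φ → B i j ≡ true
    unit⇒B i j ij∈ = let (gij , ≡1) = Equivalence.to (∈faceOf⇔ φ i j) ij∈
                     in Jump-1⇒true (B i j) (φ i - φ j) (layers i j gij) ≡1

    into-B : (i , j) ∈F faceOf φ ⊎ (j , i) ∈F faceOf φ → B i j ≡ true
    into-B (inj₁ ij∈) = unit⇒B i j ij∈
    into-B (inj₂ ji∈) = B-sym j i (unit⇒B j i ji∈)

    out-of-B : B i j ≡ true → (i , j) ∈F faceOf φ ⊎ (j , i) ∈F faceOf φ
    out-of-B Bij with subst (λ b → Jump b (φ i - φ j)) Bij (layers i j (B⊆G i j Bij))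
    ... | inj₁ ≡1  = inj₁ (Equivalence.from (∈faceOf⇔ φ i j) (B⊆G i j Bij , ≡1))
    ... | inj₂ ≡-1 = inj₂ (Equivalence.from (∈faceOf⇔ φ j i)
                            (Graph.sym G i j (B⊆G i j Bij) , trans (minus-swap (φ i) (φ j)) (cong -_ ≡-1)))

-- Sign vectors of the canonically oriented spanning tree

module CanonicalOrdering {N n : ℕ} (T : Rel N) (side : Fin N → Bool) (t : Fin n → Fin N × Fin N)
                         (canonical : IsCanonicalOrdering T side t) where

  src tgt : Fin n → Fin N
  src k = proj₁ (t k)
  tgt k = proj₂ (t k)

  t-injective : ∀ k l → t k ≡ t l → k ≡ l
  t-injective = proj₁ (proj₂ canonical)

  t-covers : ∀ x y → T x y ≡ true → ∃[ k ] (t k ≡ (x , y) ⊎ t k ≡ (y , x))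
  t-covers = proj₂ (proj₂ canonical)

  t-edge : ∀ k → T (src k) (tgt k) ≡ true
  t-edge k = proj₁ (proj₁ canonical k)

  src-side : ∀ k → side (src k) ≡ false
  src-side k = proj₁ (proj₂ (proj₁ canonical k))

  tgt-side : ∀ k → side (tgt k) ≡ true
  tgt-side k = proj₂ (proj₂ (proj₁ canonical k))

  t-no-reversal : ∀ {k l e} → t k ≡ e → t l ≢ swap e
  t-no-reversal {k} {l} refl eq with trans (sym (tgt-side l)) (trans (cong (side ∘ proj₂) eq) (src-side k))
  ... | ()

  src≢tgt : ∀ k → src k ≢ tgt k
  src≢tgt k eq = t-no-reversal {k} {k} refl (cong₂ _,_ eq (sym eq))

  edge-endpoints-differ : ∀ x y → T x y ≡ true → x ≢ y
  edge-endpoints-differ x y Txy with t-covers x y Txy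
  ... | k , inj₁ refl = src≢tgt k
  ... | k , inj₂ refl = λ eq → src≢tgt k (sym eq)

  edgeWeight-along : ∀ v {k x y} → t k ≡ (x , y) → edgeWeight t v (x , y) ≡ lookup v k
  edgeWeight-along v {k} {x} {y} tk≡ = trans
    (sum-single _ k (λ l l≢k → cong (_* lookup v l)
       (traverse-elsewhere (λ eq → l≢k (t-injective l k (trans eq (sym tk≡)))) (t-no-reversal tk≡))))
    (trans (cong (λ e → traverse e (x , y) * lookup v k) tk≡)
           (trans (cong (_* lookup v k) (traverse-along (x , y))) (ℤ.*-identityˡ (lookup v k))))

  edgeWeight-against : ∀ v {k x y} → t k ≡ (y , x) → edgeWeight t v (x , y) ≡ - lookup v k
  edgeWeight-against v {k} {x} {y} tk≡ = trans
    (sum-single _ k (λ l l≢k → cong (_* lookup v l)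
       (traverse-elsewhere (t-no-reversal tk≡) (λ eq → l≢k (t-injective l k (trans eq (sym tk≡)))))))
    (trans (cong (λ e → traverse e (x , y) * lookup v k) tk≡)
           (trans (cong (_* lookup v k) (traverse-against x≢y)) (ℤ.-1*i≡-i (lookup v k))))
    where
    x≢y : x ≢ y
    x≢y eq = src≢tgt k (trans (cong proj₁ tk≡) (trans (sym eq) (sym (cong proj₂ tk≡))))

module SignVectors {N n : ℕ} (G : Graph N) {B T : Rel N} (side : Fin N → Bool) {t : Fin n → Fin N × Fin N}
                   (B-sub : SubgraphOf B (adj G)) (tree : SpanningTreeOf B T)
                   (canonical : IsCanonicalOrdering T side t) (root : Fin N) where

  open CanonicalOrdering T side t canonical
  open Faces G
  open Paths T

  T-sym : ∀ x y → T x y ≡ true → T y x ≡ true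
  T-sym = proj₁ (proj₁ tree)

  T⊆B : T ⊆ᴱ B
  T⊆B = proj₂ (proj₁ tree)

  T⊆G : T ⊆ᴱ adj G
  T⊆G x y Txy = proj₂ B-sub x y (T⊆B x y Txy)

  T-connected : Connected T
  T-connected = proj₁ (proj₂ tree)

  open Forest T T-sym (proj₂ (proj₂ tree))

  edgeWeight-antisym : ∀ v x y → T x y ≡ true → edgeWeight t v (y , x) ≡ - edgeWeight t v (x , y)
  edgeWeight-antisym v x y Txy with t-covers x y Txy
  ... | k , inj₁ tk≡ = trans (edgeWeight-against v tk≡) (cong -_ (sym (edgeWeight-along v tk≡)))
  ... | k , inj₂ tk≡ = trans (edgeWeight-along v tk≡)
                             (trans (sym (ℤ.neg-involutive _)) (cong -_ (sym (edgeWeight-against v tk≡))))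

  signPotential : ∀ d → Σ (Fin N → ℤ) λ φ →
                  ∀ x y → T x y ≡ true → edgeWeight t (signVec d) (x , y) ≡ φ y - φ x
  signPotential d = potential edge-endpoints-differ (edgeWeight t (signVec d)) (edgeWeight-antisym (signVec d))
                              T-connected root

  potentialOf : Vec Sign n → Fin N → ℤ
  potentialOf d = proj₁ (signPotential d)

  potentialOf-edge : ∀ d x y → T x y ≡ true → edgeWeight t (signVec d) (x , y) ≡ potentialOf d y - potentialOf d x
  potentialOf-edge d = proj₂ (signPotential d)

  signWeight-along : ∀ d {k x y} → t k ≡ (x , y) → edgeWeight t (signVec d) (x , y) ≡ signℤ (lookup d k)
  signWeight-along d {k} tk≡ = trans (edgeWeight-along (signVec d) tk≡) (lookup-map k signℤ d)

  signWeight-against : ∀ d {k x y} → t k ≡ (y , x) → edgeWeight t (signVec d) (x , y) ≡ - signℤ (lookup d k)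
  signWeight-against d {k} tk≡ = trans (edgeWeight-against (signVec d) tk≡) (cong -_ (lookup-map k signℤ d))

  potentialOf-t : ∀ d k → potentialOf d (tgt k) - potentialOf d (src k) ≡ signℤ (lookup d k)
  potentialOf-t d k = trans (sym (potentialOf-edge d (src k) (tgt k) (t-edge k))) (signWeight-along d refl)

  dot-cycleVec≡potential : ∀ d {u v p} → Walk T v u p →
                           dot (cycleVec t p) (signVec d) ≡ potentialOf d u - potentialOf d v
  dot-cycleVec≡potential d {p = p} wk =
    trans (dot-cycleVec t (signVec d) p) (telescope (edgeWeight t (signVec d)) (potentialOf d) (potentialOf-edge d) wk)

  signWeight-jump : ∀ d x y → T x y ≡ true → Jump true (edgeWeight t (signVec d) (x , y))
  signWeight-jump d x y Txy with t-covers x y Txy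
  ... | k , inj₁ tk≡ = subst (Jump true) (sym (signWeight-along d tk≡)) (signℤ-jump (lookup d k))
  ... | k , inj₂ tk≡ = subst (Jump true) (sym (signWeight-against d tk≡)) (Jump-neg (signℤ-jump (lookup d k)))

  valid⇒layering : ∀ d → ValidSignVector G B T t d → IsLayering B (potentialOf d)
  valid⇒layering d valid i j gij with T i j in Tij
  ... | true  = subst₂ Jump (sym (T⊆B i j Tij))
                        (potentialOf-edge d j i (T-sym i j Tij)) (signWeight-jump d j i (T-sym i j Tij))
  ... | false with walk⇒path (proj₂ (T-connected j i))
  ...   | p , πp = subst (Jump (B i j)) (dot-cycleVec≡potential d (proj₁ πp))
                         (Jump-by-cases (B i j) _ (proj₁ (valid i j p gij Tij πp)) (proj₂ (valid i j p gij Tij πp)))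

  layering⇒valid : ∀ d → IsLayering B (potentialOf d) → ValidSignVector G B T t d
  layering⇒valid d layers u v p guv _ (wp , _) =
    subst (λ δ → (B u v ≡ true → Jump true δ) × (B u v ≡ false → Jump false δ))
          (sym (dot-cycleVec≡potential d wp)) (Jump-split (B u v) _ (layers u v guv))

  signedEdge : Sign → Fin n → Fin N × Fin N
  signedEdge Sign.+ k = (tgt k , src k)
  signedEdge Sign.- k = (src k , tgt k)

  Orients : PointSet N → Vec Sign n → Set
  Orients F d = ∀ k → signedEdge (lookup d k) k ∈F F

  signsOf : PointSet N → Vec Sign n
  signsOf F = tabulate λ k → if lookup (lookup F (tgt k)) (src k) then Sign.+ else Sign.-

  tree-differences : (f g : Fin N → ℚ) → (∀ k → f (tgt k) -ℚ f (src k) ≡ g (tgt k) -ℚ g (src k)) →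
                     ∀ x y → T x y ≡ true → f y -ℚ f x ≡ g y -ℚ g x
  tree-differences f g along-t x y Txy with t-covers x y Txy
  ... | k , inj₁ refl = along-t k
  ... | k , inj₂ refl = trans (minusℚ-swap (f x) (f y))
                              (trans (cong -ℚ_ (along-t k)) (sym (minusℚ-swap (g x) (g y))))

  signedEdge-difference : ∀ {F h m} σ k → Supports F h m → signedEdge σ k ∈F F →
                          h (tgt k) -ℚ h (src k) ≡ m *ℚ fromℤ (signℤ σ)
  signedEdge-difference {F} {h} {m} Sign.+ k (_ , mem) e∈F =
    trans (proj₂ (proj₁ (mem (tgt k) (src k)) e∈F)) (sym (ℚ.*-identityʳ m))
  signedEdge-difference {F} {h} {m} Sign.- k (_ , mem) e∈F =
    trans (minusℚ-swap (h (src k)) (h (tgt k)))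
          (trans (cong -ℚ_ (proj₂ (proj₁ (mem (src k) (tgt k)) e∈F)))
                 (trans (cong -ℚ_ (sym (ℚ.*-identityʳ m))) (ℚ.neg-distribʳ-* m 1ℚ)))

  orients⇒topFace : ∀ {F h m d} → Supports F h m → 0ℚ <ℚ m → Orients F d → IsTopFaceOf F (potentialOf d)
  orients⇒topFace {F} {h} {m} {d} supports 0<m orients =
    supports⇒topFace (supports-rescale {F} {h} {m} (fromℤ ∘ φ) supports 0<m scaled)
    where
    φ : Fin N → ℤ
    φ = potentialOf d

    mφ : Fin N → ℚ
    mφ x = m *ℚ fromℤ (φ x)

    along-t : ∀ k → h (tgt k) -ℚ h (src k) ≡ mφ (tgt k) -ℚ mφ (src k)
    along-t k = begin
      h (tgt k) -ℚ h (src k)                   ≡⟨ signedEdge-difference {F} {h} {m} (lookup d k) k supports (orients k) ⟩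
      m *ℚ fromℤ (signℤ (lookup d k))          ≡⟨ cong (λ z → m *ℚ fromℤ z) (potentialOf-t d k) ⟨
      m *ℚ fromℤ (φ (tgt k) - φ (src k))       ≡⟨ cong (m *ℚ_) (fromℤ-homo-- (φ (tgt k)) (φ (src k))) ⟩
      m *ℚ (fromℤ (φ (tgt k)) -ℚ fromℤ (φ (src k))) ≡⟨ *-distribˡ-minusℚ m _ _ ⟩
      mφ (tgt k) -ℚ mφ (src k)                 ∎
      where open ≡-Reasoning

    scaled : ∀ i j → h i -ℚ h j ≡ m *ℚ (fromℤ (φ i) -ℚ fromℤ (φ j))
    scaled i j = trans (differences-agree T-connected h mφ (tree-differences h mφ along-t) j i)
                       (sym (*-distribˡ-minusℚ m _ _))

  signsOf-orients : ∀ {F} → GraphOfFacetIs F B → Orients F (signsOf F)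
  signsOf-orients {F} graph k =
    subst (λ σ → signedEdge σ k ∈F F) (sym (lookup∘tabulate _ k)) (oriented _ refl)
    where
    oriented : ∀ b → lookup (lookup F (tgt k)) (src k) ≡ b → signedEdge (if b then Sign.+ else Sign.-) k ∈F F
    oriented true  ts∈F = ts∈F
    oriented false ts∉F with proj₂ (graph (src k) (tgt k)) (T⊆B _ _ (t-edge k))
    ... | inj₁ st∈F = st∈F
    ... | inj₂ ts∈F = contradiction (trans (sym ts∈F) ts∉F) λ ()

  faceOf-orients : ∀ d → Orients (faceOf (potentialOf d)) d
  faceOf-orients d k with lookup d k | potentialOf-t d k
  ... | Sign.+ | jump = Equivalence.from (∈faceOf⇔ (potentialOf d) (tgt k) (src k))
                          (T⊆G _ _ (T-sym _ _ (t-edge k)) , jump)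
  ... | Sign.- | jump = Equivalence.from (∈faceOf⇔ (potentialOf d) (src k) (tgt k))
                          (T⊆G _ _ (t-edge k) , trans (minus-swap (potentialOf d (tgt k)) _) (cong -_ jump))

  signsOf-faceOf : ∀ d → signsOf (faceOf (potentialOf d)) ≡ d
  signsOf-faceOf d = trans (tabulate-cong entry) (tabulate∘lookup d)
    where
    entry : ∀ k → (if lookup (lookup (faceOf (potentialOf d)) (tgt k)) (src k) then Sign.+ else Sign.-) ≡ lookup d k
    entry k with lookup d k | potentialOf-t d k | faceOf-orients d k
    ... | Sign.+ | _    | ts∈ = cong (if_then Sign.+ else Sign.-) ts∈
    ... | Sign.- | jump | _   = cong (if_then Sign.+ else Sign.-) (Bool.¬-not ts∉)
      where
      ts∉ : lookup (lookup (faceOf (potentialOf d)) (tgt k)) (src k) ≢ true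
      ts∉ ts∈ with trans (sym jump) (proj₂ (Equivalence.to (∈faceOf⇔ (potentialOf d) (tgt k) (src k)) ts∈))
      ... | ()

  facet⇒topFace : ∀ {F} → IsProperFace G F → GraphOfFacetIs F B → IsTopFaceOf F (potentialOf (signsOf F))
  facet⇒topFace {F} ((h , m , supports) , i , j , gij , ij∉F) graph =
    orients⇒topFace {F} {h} {m} {signsOf F} supports (supports-value-pos {F} {h} {m} supports gij ij∉F)
                    (signsOf-orients {F} graph)

  layering⇒facet : ∀ d → HasEdge G → IsLayering B (potentialOf d) → IsFacet G (faceOf (potentialOf d))
  layering⇒facet d hasEdge layers = (face , faceOf-proper φ hasEdge) , maximal
    where
    φ : Fin N → ℤ
    φ = potentialOf d

    face : IsFace G (faceOf φ)
    face = fromℤ ∘ φ , 1ℚ ,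
           topFace⇒supports {faceOf φ} {φ} (topFace (layering⇒bounded {B} {φ} layers) (∈faceOf⇔ φ))

    maximal : ∀ F′ → IsProperFace G F′ → faceOf φ ⊆F F′ → F′ ⊆F faceOf φ
    maximal F′ ((h , m , supports) , i , j , gij , ij∉F′) faceOf⊆F′ x y xy∈F′ =
      subst (λ F → (x , y) ∈F F) (topFace⇒≡faceOf F′-top) xy∈F′
      where
      F′-top : IsTopFaceOf F′ φ
      F′-top = orients⇒topFace {F′} {h} {m} {d} supports (supports-value-pos {F′} {h} {m} supports gij ij∉F′)
                               (λ k → faceOf⊆F′ _ _ (faceOf-orients d k))

mainTheorem6 :
    (n : ℕ) (G : Graph (suc n)) → Connected (adj G) → HasEdge G →
    (B : Rel (suc n)) (side : Fin (suc n) → Bool) →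
    MaximalBipartiteSubgraph G B → IsBipartition B side →
    (T : Rel (suc n)) → SpanningTreeOf B T →
    (t : Fin n → Fin (suc n) × Fin (suc n)) → IsCanonicalOrdering T side t →
    Σ (PointSet (suc n) → Vec Sign n) λ f →
      (∀ F → IsFacet G F → GraphOfFacetIs F B → ValidSignVector G B T t (f F))
      × (∀ d → ValidSignVector G B T t d →
           ∃[ F ] (IsFacet G F × GraphOfFacetIs F B × f F ≡ d
                   × (∀ F' → IsFacet G F' → GraphOfFacetIs F' B → f F' ≡ d → F' ≡ F)))
mainTheorem6 n G _ hasEdge B side (B-sub , _) _ T tree t canonical = signsOf , facet⇒valid , valid⇒facet
  where
  open SignVectors G side B-sub tree canonical zero
  open Faces G

  facet⇒valid : ∀ F → IsFacet G F → GraphOfFacetIs F B → ValidSignVector G B T t (signsOf F)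
  facet⇒valid F (proper , _) graph =
    layering⇒valid (signsOf F) (topFace⇒layering (facet⇒topFace {F} proper graph) graph)

  valid⇒facet : ∀ d → ValidSignVector G B T t d →
    ∃[ F ] (IsFacet G F × GraphOfFacetIs F B × signsOf F ≡ d
            × (∀ F' → IsFacet G F' → GraphOfFacetIs F' B → signsOf F' ≡ d → F' ≡ F))
  valid⇒facet d valid =
      faceOf (potentialOf d)
    , layering⇒facet d hasEdge layers
    , layering⇒graphOfFacet {B} {potentialOf d} (proj₁ B-sub) (proj₂ B-sub) layers
    , signsOf-faceOf d
    , λ F' (proper , _) graph signs≡d →
        trans (topFace⇒≡faceOf (facet⇒topFace {F'} proper graph)) (cong (faceOf ∘ potentialOf) signs≡d)
    where
    layers : IsLayering B (potentialOf d)
    layers = valid⇒layering d valid
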